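{- Let $o$ be a $\lambda\mu$-object, $\alpha$ a name and $u$ a term with $\alpha\notin\mathrm{fn}(u)$. If $\Phi'$ is an $\mathcal{S}_{\lambda\mu}$ derivation of $\Gamma'\vdash o\{\alpha/\!\!/u\}:\mathcal{A}\mid\alpha:\mathcal{V};\Delta'$, then there exist $\Gamma,\Delta,\Gamma_u,\Delta_u$ and families $(\mathcal{I}_k)_{k\in K}$ of intersection types and $(\mathcal{V}_k)_{k\in K}$ of union types such that $\Gamma'=\Gamma\wedge\Gamma_u$, $\Delta'=\Delta\vee\Delta_u$, $\mathcal{V}=\vee_{k\in K}\mathcal{V}_k$, the judgment $\Gamma\vdash o:\mathcal{A}\mid\alpha:\langle\mathcal{I}_k\Rightarrow\mathcal{V}_k\rangle_{k\in K};\Delta$ is derivable in $\mathcal{S}_{\lambda\mu}$, and $\Gamma_u\Vdash u:\wedge_{k\in K}(\mathcal{I}_k)^{*}\mid\Delta_u$ is derivable in $\mathcal{S}_{\lambda\mu}$.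
   Context: $\lambda\mu$-objects: terms $t,u::=x\mid\lambda x.t\mid t\,u\mid\mu\alpha.c$, commands $c::=[\alpha]t$, objects $o::=t\mid c$ ($x$ variables, $\alpha$ names); $\lambda x$ binds $x$, $\mu\alpha$ binds $\alpha$; $\mathrm{fn}$ = free names ($\mathrm{fn}([\alpha]t)=\mathrm{fn}(t)\cup\{\alpha\}$); objects up to renaming of bound symbols. The replacement $o\{\alpha/\!\!/u\}$ (capture-avoiding) is defined by $x\{\alpha/\!\!/u\}=x$, homomorphically on abstraction, application and $\mu\gamma$, $([\gamma]t)\{\alpha/\!\!/u\}=[\gamma](t\{\alpha/\!\!/u\})$ for $\gamma\neq\alpha$, $([\alpha]t)\{\alpha/\!\!/u\}=[\alpha]((t\{\alpha/\!\!/u\})\,u)$. Types: base types $a$; $\sigma::=a\mid\mathcal{I}\Rightarrow\mathcal{U}$; union types $\mathcal{U}=\langle\sigma_k\rangle_{k\in K}$ (finite multisets of types); intersection types $\mathcal{I}=[\mathcal{U}_k]_{k\in K}$ (finite multisets of union types); object types $\mathcal{A}$ are union types or $\#$. Blind types $\xi::=a\mid[\,]\Rightarrow\langle\xi\rangle$. $\wedge,\vee$ = multiset union. Choice: $\mathcal{I}^{*}=\mathcal{I}$ if $\mathcal{I}\neq[\,]$, $[\,]^{*}=[\mathcal{U}]$ for an arbitrary non-empty $\mathcal{U}$; $\mathcal{U}^{*}=\mathcal{U}$ if $\mathcal{U}\neq\langle\,\rangle$, $\langle\,\rangle^{*}=\langle\xi\rangle$ for an arbitrary blind $\xi$. Variable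 assignments $\Gamma$ (to intersection types), name assignments $\Delta$ (to union types), domains = elements with non-empty image; $\wedge,\vee$ pointwise; $\alpha:\mathcal{V};\Delta$ denotes $\Delta\vee\alpha:\mathcal{V}$ with $\alpha\notin\mathrm{dom}(\Delta)$; $\Gamma\setminus x$, $\Delta\setminus\alpha$ empty an entry. System $\mathcal{S}_{\lambda\mu}$: (ax) $x:[\mathcal{U}]\vdash x:\mathcal{U}\mid\emptyset$ if $\mathcal{U}\neq\langle\,\rangle$; ($\Rightarrow_i$) from $\Gamma\vdash t:\mathcal{U}\mid\Delta$ infer $\Gamma\setminus x\vdash\lambda x.t:\langle\Gamma(x)\Rightarrow\mathcal{U}\rangle\mid\Delta$; ($\#_i$) from $\Gamma\vdash t:\mathcal{U}\mid\Delta$ infer $\Gamma\vdash[\alpha]t:\#\mid\Delta\vee\{\alpha:\mathcal{U}\}$; ($\#_e$) from $\Gamma\vdash c:\#\mid\Delta$ infer $\Gamma\vdash\mu\alpha.c:(\Delta(\alpha))^{*}\mid\Delta\setminus\alpha$; ($\wedge$) from $(\Gamma_k\vdash t:\mathcal{U}_k\mid\Delta_k)_{k\in K}$ ($K$ possibly empty) infer $\wedge_k\Gamma_k\Vdash t:[\mathcal{U}_k]_{k\in K}\mid\vee_k\Delta_k$; ($\Rightarrow_{e*}$) from $\Gamma_t\vdash t:\langle\mathcal{I}_k\Rightarrow\mathcal{U}_k\rangle_{k\in K}\mid\Delta_t$ and $\Gamma_u\Vdash u:\wedge_k(\mathcal{I}_k)^{*}\mid\Delta_u$ infer $\Gamma_t\wedge\Gamma_u\vdash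 t\,u:\vee_k\mathcal{U}_k\mid\Delta_t\vee\Delta_u$. -}

module Defs where

open import Data.Nat using (ℕ; zero; suc; _≡ᵇ_)
open import Data.Bool using (if_then_else_)
open import Data.List using (List; []; _∷_; _++_; map; concat; concatMap)
open import Data.List.Relation.Binary.Pointwise using (Pointwise)
open import Data.List.Relation.Binary.Permutation.Homogeneous using (Permutation)
open import Data.Product using (_×_; _,_; proj₁; proj₂; ∃; Σ-syntax)
open import Relation.Binary.PropositionalEquality using (_≡_; _≢_)

-- λμ-objects, de Bruijn representation (two independent index spaces:
-- term variables and names).  Objects up to renaming of bound symbols
-- = syntactic equality on de Bruijn terms.

mutual
  data Term : Set where
    var : ℕ → Term
    lam : Term → Term
    app : Term → Term → Term
    mu  : Cmd → Term            -- μα.c   (binds name index 0)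

  data Cmd : Set where
    named : ℕ → Term → Cmd

data Obj : Set where
  term : Term → Obj
  cmd  : Cmd → Obj

mutual
  shiftVT : ℕ → Term → Term
  shiftVT c (var x) = if c Data.Nat.≤ᵇ x then var (suc x) else var x
  shiftVT c (lam t) = lam (shiftVT (suc c) t)
  shiftVT c (app t s) = app (shiftVT c t) (shiftVT c s)
  shiftVT c (mu k) = mu (shiftVC c k)

  shiftVC : ℕ → Cmd → Cmd
  shiftVC c (named β t) = named β (shiftVT c t)

mutual
  shiftNT : ℕ → Term → Term
  shiftNT c (var x) = var x
  shiftNT c (lam t) = lam (shiftNT c t)
  shiftNT c (app t s) = app (shiftNT c t) (shiftNT c s)
  shiftNT c (mu k) = mu (shiftNC (suc c) k)

  shiftNC : ℕ → Cmd → Cmd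
  shiftNC c (named β t) = named (if c Data.Nat.≤ᵇ β then suc β else β) (shiftNT c t)

mutual
  replT : Term → ℕ → Term → Term
  replT (var x) α u = var x
  replT (lam t) α u = lam (replT t α (shiftVT 0 u))
  replT (app t s) α u = app (replT t α u) (replT s α u)
  replT (mu c) α u = mu (replC c (suc α) (shiftNT 0 u))

  replC : Cmd → ℕ → Term → Cmd
  replC (named γ t) α u =
    if γ ≡ᵇ α then named γ (app (replT t α u) u) else named γ (replT t α u)

repl : Obj → ℕ → Term → Obj
repl (term t) α u = term (replT t α u)
repl (cmd c) α u = cmd (replC c α u)

mutual
  data _∈fnT_ : ℕ → Term → Set where
    fn-lam  : ∀ {α t} → α ∈fnT t → α ∈fnT lam t
    fn-appˡ : ∀ {α t s} → α ∈fnT t → α ∈fnT app t s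
    fn-appʳ : ∀ {α t s} → α ∈fnT s → α ∈fnT app t s
    fn-mu   : ∀ {α c} → suc α ∈fnC c → α ∈fnT mu c

  data _∈fnC_ : ℕ → Cmd → Set where
    fn-here  : ∀ {α t} → α ∈fnC named α t
    fn-there : ∀ {α γ t} → α ∈fnT t → α ∈fnC named γ t

-- Types.  Multisets are represented by lists, compared up to
-- (nested) permutation, see _≈T_ below.

mutual
  data Ty : Set where
    base : ℕ → Ty
    _⇒_  : Inter → Uni → Ty

  Uni : Set
  Uni = List Ty

  Inter : Set
  Inter = List Uni

data ObjTy : Set where
  uty  : Uni → ObjTy
  hash : ObjTy

data Blind : Ty → Set where
  blind-base : ∀ a → Blind (base a)
  blind-arr  : ∀ {ξ} → Blind ξ → Blind ([] ⇒ (ξ ∷ []))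

data _≈T_ : Ty → Ty → Set where
  base≈ : ∀ a → base a ≈T base a
  arr≈  : ∀ {I I' U U'} → Permutation (Permutation _≈T_) I I'
        → Permutation _≈T_ U U' → (I ⇒ U) ≈T (I' ⇒ U')

_≈U_ : Uni → Uni → Set
_≈U_ = Permutation _≈T_

_≈I_ : Inter → Inter → Set
_≈I_ = Permutation _≈U_

data _≈A_ : ObjTy → ObjTy → Set where
  uty≈  : ∀ {U U'} → U ≈U U' → uty U ≈A uty U'
  hash≈ : hash ≈A hash

-- choice operators as relations:  StarI I J  means  J is a possible I*
data StarI : Inter → Inter → Set where
  starI-ne : ∀ U I → StarI (U ∷ I) (U ∷ I)
  starI-e  : ∀ U → U ≢ [] → StarI [] (U ∷ [])

data StarU : Uni → Uni → Set where
  starU-ne : ∀ σ U → StarU (σ ∷ U) (σ ∷ U)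
  starU-e  : ∀ ξ → Blind ξ → StarU [] (ξ ∷ [])

-- Assignments (finite support is automatic for derivable judgments)

VarCtx : Set
VarCtx = ℕ → Inter

NameCtx : Set
NameCtx = ℕ → Uni

emptyV : VarCtx
emptyV _ = []

emptyN : NameCtx
emptyN _ = []

singleV : ℕ → Inter → VarCtx
singleV x I y = if y ≡ᵇ x then I else []

singleN : ℕ → Uni → NameCtx
singleN α U β = if β ≡ᵇ α then U else []

_∧_ : VarCtx → VarCtx → VarCtx
(Γ ∧ Γ') x = Γ x ++ Γ' x

_∨_ : NameCtx → NameCtx → NameCtx
(Δ ∨ Δ') α = Δ α ++ Δ' α

_≈Γ_ : VarCtx → VarCtx → Set
Γ ≈Γ Γ' = ∀ x → Γ x ≈I Γ' x

_≈Δ_ : NameCtx → NameCtx → Set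
Δ ≈Δ Δ' = ∀ α → Δ α ≈U Δ' α

arrows : List (Inter × Uni) → Uni
arrows = map (λ p → proj₁ p ⇒ proj₂ p)

-- System S_λμ  (de Bruijn: Γ ∘ suc is Γ\x after leaving the binder)

mutual
  data _⊢t_∶_∣_ : VarCtx → Term → Uni → NameCtx → Set where
    ax : ∀ x U → U ≢ [] → singleV x (U ∷ []) ⊢t var x ∶ U ∣ emptyN
    ⇒i : ∀ {Γ t U Δ} → Γ ⊢t t ∶ U ∣ Δ
       → (λ x → Γ (suc x)) ⊢t lam t ∶ ((Γ 0 ⇒ U) ∷ []) ∣ Δ
    #e : ∀ {Γ c Δ U} → Γ ⊢c c ∶#∣ Δ → StarU (Δ 0) U
       → Γ ⊢t mu c ∶ U ∣ (λ β → Δ (suc β))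
    ⇒e* : ∀ {Γt Γu t u Δt Δu} (ps : List (Inter × Uni)) (js : List Inter)
        → Γt ⊢t t ∶ arrows ps ∣ Δt
        → Pointwise StarI (map proj₁ ps) js
        → Γu ⊩ u ∶ concat js ∣ Δu
        → (Γt ∧ Γu) ⊢t app t u ∶ concatMap proj₂ ps ∣ (Δt ∨ Δu)

  data _⊢c_∶#∣_ : VarCtx → Cmd → NameCtx → Set where
    #i : ∀ {Γ t U Δ} α → Γ ⊢t t ∶ U ∣ Δ → Γ ⊢c named α t ∶#∣ (Δ ∨ singleN α U)

  -- rule (∧), family given as a list (possibly empty)
  data _⊩_∶_∣_ : VarCtx → Term → Inter → NameCtx → Set where
    ∧-nil  : ∀ {t} → emptyV ⊩ t ∶ [] ∣ emptyN
    ∧-cons : ∀ {Γ₁ Γ₂ t U I Δ₁ Δ₂} → Γ₁ ⊢t t ∶ U ∣ Δ₁ → Γ₂ ⊩ t ∶ I ∣ Δ₂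
           → (Γ₁ ∧ Γ₂) ⊩ t ∶ (U ∷ I) ∣ (Δ₁ ∨ Δ₂)

data _⊢o_∶_∣_ : VarCtx → Obj → ObjTy → NameCtx → Set where
  o-term : ∀ {Γ t U Δ} → Γ ⊢t t ∶ U ∣ Δ → Γ ⊢o term t ∶ uty U ∣ Δ
  o-cmd  : ∀ {Γ c Δ} → Γ ⊢c c ∶#∣ Δ → Γ ⊢o cmd c ∶ hash ∣ Δ

-- derivability of a judgment, with assignments and types read as
-- multisets (i.e. up to ≈)
DerivableO : VarCtx → Obj → ObjTy → NameCtx → Set
DerivableO Γ o A Δ = Σ[ Γ₀ ∈ VarCtx ] Σ[ A₀ ∈ ObjTy ] Σ[ Δ₀ ∈ NameCtx ]
  (Γ₀ ≈Γ Γ × A₀ ≈A A × Δ₀ ≈Δ Δ × Γ₀ ⊢o o ∶ A₀ ∣ Δ₀)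

DerivableI : VarCtx → Term → Inter → NameCtx → Set
DerivableI Γ t I Δ = Σ[ Γ₀ ∈ VarCtx ] Σ[ I₀ ∈ Inter ] Σ[ Δ₀ ∈ NameCtx ]
  (Γ₀ ≈Γ Γ × I₀ ≈I I × Δ₀ ≈Δ Δ × Γ₀ ⊩ t ∶ I₀ ∣ Δ₀)

module Submission where

-- Each [α]t becomes [α](t{α//u} u); the derivation of that application types
-- t{α//u} with arrows ⟨I_k ⇒ V_k⟩ and u with ∧_k I_k*, so α is retyped in o by
-- these arrows while the derivations of u are collected on the side.  The
-- invariant is the record Split: a derivation of the replaced object with
-- assignments Γ₁, Δ₁ yields derivations of o (Γo, Δo) and of u (Γu, Δu) such
-- that Γ₁ and, away from α, Δ₁ are exact *interleavings* of the two parts.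
-- Exactness makes the assignments agree on the nose where u contributes
-- nothing, as the binder rules (⇒i reads Γ 0, #e reads Δ 0) require; they
-- become multiset equalities only in the final step.

open import Defs
open import Data.Nat using (ℕ; zero; suc; _≡ᵇ_; _≤ᵇ_; _<ᵇ_; _≤_; z≤n; s≤s; _≟_)
open import Data.Nat.Properties
  using (≡ᵇ⇒≡; ≤ᵇ⇒≤; ≤⇒≤ᵇ; suc-injective; ≤-refl; m≤n⇒m≤1+n; <-irrefl)
open import Data.Bool using (true; false; if_then_else_; T)
open import Data.Unit using (tt)
open import Data.List using (List; []; _∷_; _++_; map; concat; concatMap)
open import Data.List.Properties using (++-identityʳ; ++-assoc; map-++; concat-++; concatMap-++)
open import Data.List.Relation.Binary.Pointwise as Pointwise using (Pointwise; []; _∷_)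
import Data.List.Relation.Binary.Permutation.Homogeneous as Perm
open import Data.List.Relation.Ternary.Interleaving.Propositional
  using (Interleaving; []; consˡ; consʳ)
import Data.List.Relation.Ternary.Interleaving.Properties as Interleaving
open import Data.Product using (_×_; _,_; proj₁; proj₂; Σ-syntax)
open import Function using (_∘_)
open import Level using (0ℓ)
open import Relation.Binary.Bundles using (Setoid)
open import Relation.Binary.PropositionalEquality
  using (_≡_; _≢_; _≗_; refl; sym; trans; cong; cong₂; subst; subst₂)
open import Relation.Nullary using (¬_; yes; no)
open import Data.Empty using (⊥-elim)

mutual
  reflT : ∀ σ → σ ≈T σ
  reflT (base a) = base≈ a
  reflT (I ⇒ U) = arr≈ (reflI I) (reflU U)

  reflU : ∀ U → U ≈U U
  reflU U = Perm.refl (reflPU U)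

  reflPU : ∀ U → Pointwise _≈T_ U U
  reflPU [] = []
  reflPU (σ ∷ U) = reflT σ ∷ reflPU U

  reflI : ∀ I → I ≈I I
  reflI I = Perm.refl (reflPI I)

  reflPI : ∀ I → Pointwise _≈U_ I I
  reflPI [] = []
  reflPI (U ∷ I) = reflU U ∷ reflPI I

mutual
  symT : ∀ {σ τ} → σ ≈T τ → τ ≈T σ
  symT (base≈ a) = base≈ a
  symT (arr≈ p q) = arr≈ (symI p) (symU q)

  symU : ∀ {U V} → U ≈U V → V ≈U U
  symU (Perm.refl p) = Perm.refl (symPU p)
  symU (Perm.prep e p) = Perm.prep (symT e) (symU p)
  symU (Perm.swap e f p) = Perm.swap (symT f) (symT e) (symU p)
  symU (Perm.trans p q) = Perm.trans (symU q) (symU p)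

  symPU : ∀ {U V} → Pointwise _≈T_ U V → Pointwise _≈T_ V U
  symPU [] = []
  symPU (e ∷ p) = symT e ∷ symPU p

  symI : ∀ {I J} → I ≈I J → J ≈I I
  symI (Perm.refl p) = Perm.refl (symPI p)
  symI (Perm.prep e p) = Perm.prep (symU e) (symI p)
  symI (Perm.swap e f p) = Perm.swap (symU f) (symU e) (symI p)
  symI (Perm.trans p q) = Perm.trans (symI q) (symI p)

  symPI : ∀ {I J} → Pointwise _≈U_ I J → Pointwise _≈U_ J I
  symPI [] = []
  symPI (e ∷ p) = symU e ∷ symPI p

transT : ∀ {σ τ ρ} → σ ≈T τ → τ ≈T ρ → σ ≈T ρ
transT (base≈ a) (base≈ .a) = base≈ a
transT (arr≈ p q) (arr≈ p' q') = arr≈ (Perm.trans p p') (Perm.trans q q')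

TySetoid : Setoid _ _
TySetoid = record
  { Carrier = Ty ; _≈_ = _≈T_
  ; isEquivalence = record { refl = reflT _ ; sym = symT ; trans = transT } }

UniSetoid : Setoid _ _
UniSetoid = record
  { Carrier = Uni ; _≈_ = _≈U_
  ; isEquivalence = record { refl = reflU _ ; sym = symU ; trans = Perm.trans } }

module InterleavingPermutation (S : Setoid 0ℓ 0ℓ) where
  open Setoid S using (Carrier)
  import Data.List.Relation.Binary.Permutation.Setoid S as Permutation
  open Permutation using (_↭_; ↭-refl; ↭-prep; ↭-trans)
  open Permutation public using (↭-sym; ↭-reflexive; module PermutationReasoning)
  open import Data.List.Relation.Binary.Permutation.Setoid.Properties S
    using (↭-shift)

  interleaving⇒↭ : ∀ {l r xs : List Carrier} → Interleaving l r xs → xs ↭ l ++ r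
  interleaving⇒↭ [] = ↭-refl
  interleaving⇒↭ (consˡ sp) = ↭-prep _ (interleaving⇒↭ sp)
  interleaving⇒↭ {l} {r ∷ rs} (consʳ sp) =
    ↭-trans (↭-prep r (interleaving⇒↭ sp)) (↭-sym (↭-shift l rs))

module U = InterleavingPermutation TySetoid
module I = InterleavingPermutation UniSetoid

interleaveˡ : ∀ {A : Set} (xs : List A) → Interleaving xs [] xs
interleaveˡ [] = []
interleaveˡ (x ∷ xs) = consˡ (interleaveˡ xs)

interleaveʳ : ∀ {A : Set} (xs : List A) → Interleaving [] xs xs
interleaveʳ [] = []
interleaveʳ (x ∷ xs) = consʳ (interleaveʳ xs)

interleave-[]ʳ : ∀ {A : Set} {l r xs : List A} → Interleaving l r xs → r ≡ [] → l ≡ xs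
interleave-[]ʳ [] refl = refl
interleave-[]ʳ (consˡ sp) e = cong (_ ∷_) (interleave-[]ʳ sp e)

sh : ℕ → ℕ → ℕ
sh c y = if c ≤ᵇ y then suc y else y

≤ᵇ-true : ∀ {c a} → (c ≤ᵇ a) ≡ true → c ≤ a
≤ᵇ-true {c} {a} eq = ≤ᵇ⇒≤ c a (subst T (sym eq) tt)

≤ᵇ-false : ∀ {c a} → (c ≤ᵇ a) ≡ false → ¬ c ≤ a
≤ᵇ-false eq le = subst T eq (≤⇒≤ᵇ le)

sh-suc : ∀ c y → sh (suc c) (suc y) ≡ suc (sh c y)
sh-suc zero y = refl
sh-suc (suc c) y with c <ᵇ y
... | true = refl
... | false = refl

sh-avoids : ∀ c x → c ≢ sh c x
sh-avoids c x with c ≤ᵇ x in eq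
... | true = λ e → <-irrefl refl (subst (_≤ x) e (≤ᵇ-true eq))
... | false = λ e → ≤ᵇ-false eq (subst (c ≤_) e ≤-refl)

sh-injective : ∀ c {a b} → sh c a ≡ sh c b → a ≡ b
sh-injective c {a} {b} e with c ≤ᵇ a in ea | c ≤ᵇ b in eb
... | true | true = suc-injective e
... | false | false = e
... | true | false = ⊥-elim (≤ᵇ-false eb (subst (c ≤_) e (m≤n⇒m≤1+n (≤ᵇ-true ea))))
... | false | true = ⊥-elim (≤ᵇ-false ea (subst (c ≤_) (sym e) (m≤n⇒m≤1+n (≤ᵇ-true eb))))

≡ᵇ-refl : ∀ m → (m ≡ᵇ m) ≡ true
≡ᵇ-refl zero = refl
≡ᵇ-refl (suc m) = ≡ᵇ-refl m

≡ᵇ-false : ∀ {m n} → m ≢ n → (m ≡ᵇ n) ≡ false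
≡ᵇ-false {m} {n} ne with m ≡ᵇ n in eq
... | false = refl
... | true = ⊥-elim (ne (≡ᵇ⇒≡ m n (subst T (sym eq) tt)))

≡ᵇ-false⇒≢ : ∀ {γ α} → (γ ≡ᵇ α) ≡ false → α ≢ γ
≡ᵇ-false⇒≢ {γ} eq refl with trans (sym (≡ᵇ-refl γ)) eq
... | ()

≡ᵇ-sh : ∀ c y x → (sh c y ≡ᵇ sh c x) ≡ (y ≡ᵇ x)
≡ᵇ-sh c y x with y ≟ x
... | yes refl = trans (≡ᵇ-refl (sh c y)) (sym (≡ᵇ-refl y))
... | no ne = trans (≡ᵇ-false (ne ∘ sh-injective c)) (sym (≡ᵇ-false ne))

singleV-sh : ∀ c x (I : Inter) → singleV (sh c x) I ∘ sh c ≗ singleV x I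
singleV-sh c x I y rewrite ≡ᵇ-sh c y x = refl

singleN-sh : ∀ c x (U : Uni) → singleN (sh c x) U ∘ sh c ≗ singleN x U
singleN-sh c x U y rewrite ≡ᵇ-sh c y x = refl

singleV-off : ∀ {x y} (I : Inter) → y ≢ x → singleV x I y ≡ []
singleV-off I ne rewrite ≡ᵇ-false ne = refl

singleN-off : ∀ {x y} (U : Uni) → y ≢ x → singleN x U y ≡ []
singleN-off U ne rewrite ≡ᵇ-false ne = refl

singleN-at : ∀ x (U : Uni) → singleN x U x ≡ U
singleN-at x U rewrite ≡ᵇ-refl x = refl

shiftVT-var : ∀ c x → shiftVT c (var x) ≡ var (sh c x)
shiftVT-var c x with c ≤ᵇ x
... | true = refl
... | false = refl

mutual
  fn-shiftVT : ∀ {α} c t → α ∈fnT shiftVT c t → α ∈fnT t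
  fn-shiftVT c (var x) h with c ≤ᵇ x | h
  ... | true | ()
  ... | false | ()
  fn-shiftVT c (lam t) (fn-lam h) = fn-lam (fn-shiftVT (suc c) t h)
  fn-shiftVT c (app t s) (fn-appˡ h) = fn-appˡ (fn-shiftVT c t h)
  fn-shiftVT c (app t s) (fn-appʳ h) = fn-appʳ (fn-shiftVT c s h)
  fn-shiftVT c (mu k) (fn-mu h) = fn-mu (fn-shiftVC c k h)

  fn-shiftVC : ∀ {α} c k → α ∈fnC shiftVC c k → α ∈fnC k
  fn-shiftVC c (named β t) fn-here = fn-here
  fn-shiftVC c (named β t) (fn-there h) = fn-there (fn-shiftVT c t h)

mutual
  fn-shiftNT : ∀ {α} c t → c ≤ α → suc α ∈fnT shiftNT c t → α ∈fnT t
  fn-shiftNT c (var x) le ()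
  fn-shiftNT c (lam t) le (fn-lam h) = fn-lam (fn-shiftNT c t le h)
  fn-shiftNT c (app t s) le (fn-appˡ h) = fn-appˡ (fn-shiftNT c t le h)
  fn-shiftNT c (app t s) le (fn-appʳ h) = fn-appʳ (fn-shiftNT c s le h)
  fn-shiftNT c (mu k) le (fn-mu h) = fn-mu (fn-shiftNC (suc c) k (s≤s le) h)

  fn-shiftNC : ∀ {α} c k → c ≤ α → suc α ∈fnC shiftNC c k → α ∈fnC k
  fn-shiftNC c (named β t) le h with c ≤ᵇ β in eq
  fn-shiftNC c (named β t) le fn-here | true = fn-here
  fn-shiftNC c (named β t) le fn-here | false = ⊥-elim (≤ᵇ-false eq (m≤n⇒m≤1+n le))
  fn-shiftNC c (named β t) le (fn-there h) | _ = fn-there (fn-shiftNT c t le h)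

mutual
  unassignedT : ∀ {α Γ u U Δ} → ¬ α ∈fnT u → Γ ⊢t u ∶ U ∣ Δ → Δ α ≡ []
  unassignedT α∉ (ax x U ne) = refl
  unassignedT α∉ (⇒i Φ) = unassignedT (α∉ ∘ fn-lam) Φ
  unassignedT α∉ (#e Φ st) = unassignedC (α∉ ∘ fn-mu) Φ
  unassignedT α∉ (⇒e* ps js Φ st Ψ) =
    cong₂ _++_ (unassignedT (α∉ ∘ fn-appˡ) Φ) (unassignedI (α∉ ∘ fn-appʳ) Ψ)

  unassignedC : ∀ {α Γ c Δ} → ¬ α ∈fnC c → Γ ⊢c c ∶#∣ Δ → Δ α ≡ []
  unassignedC {α} α∉ (#i {U = U} γ Φ) with α ≟ γ
  ... | yes refl = ⊥-elim (α∉ fn-here)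
  ... | no ne = cong₂ _++_ (unassignedT (α∉ ∘ fn-there) Φ) (singleN-off U ne)

  unassignedI : ∀ {α Γ u I Δ} → ¬ α ∈fnT u → Γ ⊩ u ∶ I ∣ Δ → Δ α ≡ []
  unassignedI α∉ ∧-nil = refl
  unassignedI α∉ (∧-cons Φ Ψ) = cong₂ _++_ (unassignedT α∉ Φ) (unassignedI α∉ Ψ)

-- A derivation of R whose assignments are, pointwise, the concatenations
-- of those of two given derivations.  (Assignments are functions, so
-- derivations only compose up to pointwise equality.)
record Joint (R : VarCtx → NameCtx → Set) (Γa Γb : VarCtx) (Δa Δb : NameCtx) : Set where
  constructor joint
  field
    {Γ} : VarCtx
    {Δ} : NameCtx
    Γ≗ : Γ ≗ Γa ∧ Γb
    Δ≗ : Δ ≗ Δa ∨ Δb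
    derivation : R Γ Δ

exactJoint : ∀ {R Γa Γb Δa Δb} → R (Γa ∧ Γb) (Δa ∨ Δb) → Joint R Γa Γb Δa Δb
exactJoint = joint (λ _ → refl) (λ _ → refl)

⊩-++ : ∀ {u Γa Ia Δa Γb Ib Δb} → Γa ⊩ u ∶ Ia ∣ Δa → Γb ⊩ u ∶ Ib ∣ Δb
     → Joint (λ Γ Δ → Γ ⊩ u ∶ Ia ++ Ib ∣ Δ) Γa Γb Δa Δb
⊩-++ ∧-nil Ψ = exactJoint Ψ
⊩-++ {Γb = Γb} {Δb = Δb} (∧-cons {Γ₁ = Γ₁} {Γ₂} {Δ₁ = Δ₁} {Δ₂} Φ Φs) Ψ with ⊩-++ Φs Ψ
... | joint Γ≗ Δ≗ Ψ' =
  joint (λ x → trans (cong (Γ₁ x ++_) (Γ≗ x)) (sym (++-assoc (Γ₁ x) (Γ₂ x) (Γb x))))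
        (λ β → trans (cong (Δ₁ β ++_) (Δ≗ β)) (sym (++-assoc (Δ₁ β) (Δ₂ β) (Δb β))))
        (∧-cons Φ Ψ')

mutual
  unshiftVT : ∀ c u {Γ U Δ} → Γ ⊢t shiftVT c u ∶ U ∣ Δ
    → Σ[ G ∈ VarCtx ] (G ≗ Γ ∘ sh c × Γ c ≡ [] × G ⊢t u ∶ U ∣ Δ)
  unshiftVT c (var x) {Γ} {U} {Δ} Φ =
    unshiftVar c x (subst (λ s → Γ ⊢t s ∶ U ∣ Δ) (shiftVT-var c x) Φ)
  unshiftVT c (lam t) (⇒i {Γ = Γ} {U = U} {Δ = Δ} Φ) with unshiftVT (suc c) t Φ
  ... | G , G≗ , Γc , Φ' =
    G ∘ suc , (λ y → trans (G≗ (suc y)) (cong Γ (sh-suc c y))) , Γc ,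
    subst (λ I → (G ∘ suc) ⊢t lam t ∶ ((I ⇒ U) ∷ []) ∣ Δ) (G≗ 0) (⇒i Φ')
  unshiftVT c (app t s) (⇒e* ps js Φ st Ψ) with unshiftVT c t Φ | unshiftVI c s Ψ
  ... | G , G≗ , Γc , Φ' | H , H≗ , Γc' , Ψ' =
    G ∧ H , (λ y → cong₂ _++_ (G≗ y) (H≗ y)) , cong₂ _++_ Γc Γc' , ⇒e* ps js Φ' st Ψ'
  unshiftVT c (mu k) (#e Φ st) with unshiftVC c k Φ
  ... | G , G≗ , Γc , Φ' = G , G≗ , Γc , #e Φ' st

  unshiftVar : ∀ c x {Γ U Δ} → Γ ⊢t var (sh c x) ∶ U ∣ Δ
    → Σ[ G ∈ VarCtx ] (G ≗ Γ ∘ sh c × Γ c ≡ [] × G ⊢t var x ∶ U ∣ Δ)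
  unshiftVar c x (ax _ U ne) =
    singleV x (U ∷ []) , (sym ∘ singleV-sh c x (U ∷ [])) ,
    singleV-off (U ∷ []) (sh-avoids c x) , ax x U ne

  unshiftVC : ∀ c k {Γ Δ} → Γ ⊢c shiftVC c k ∶#∣ Δ
    → Σ[ G ∈ VarCtx ] (G ≗ Γ ∘ sh c × Γ c ≡ [] × G ⊢c k ∶#∣ Δ)
  unshiftVC c (named β t) (#i _ Φ) with unshiftVT c t Φ
  ... | G , G≗ , Γc , Φ' = G , G≗ , Γc , #i β Φ'

  unshiftVI : ∀ c u {Γ I Δ} → Γ ⊩ shiftVT c u ∶ I ∣ Δ
    → Σ[ G ∈ VarCtx ] (G ≗ Γ ∘ sh c × Γ c ≡ [] × G ⊩ u ∶ I ∣ Δ)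
  unshiftVI c u ∧-nil = emptyV , (λ _ → refl) , refl , ∧-nil
  unshiftVI c u (∧-cons Φ Ψ) with unshiftVT c u Φ | unshiftVI c u Ψ
  ... | G , G≗ , Γc , Φ' | H , H≗ , Γc' , Ψ' =
    G ∧ H , (λ y → cong₂ _++_ (G≗ y) (H≗ y)) , cong₂ _++_ Γc Γc' , ∧-cons Φ' Ψ'

mutual
  unshiftNT : ∀ c u {Γ U Δ} → Γ ⊢t shiftNT c u ∶ U ∣ Δ
    → Σ[ D ∈ NameCtx ] (D ≗ Δ ∘ sh c × Δ c ≡ [] × Γ ⊢t u ∶ U ∣ D)
  unshiftNT c (var x) (ax _ U ne) = emptyN , (λ _ → refl) , refl , ax x U ne
  unshiftNT c (lam t) (⇒i Φ) with unshiftNT c t Φ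
  ... | D , D≗ , Δc , Φ' = D , D≗ , Δc , ⇒i Φ'
  unshiftNT c (app t s) (⇒e* ps js Φ st Ψ) with unshiftNT c t Φ | unshiftNI c s Ψ
  ... | D , D≗ , Δc , Φ' | E , E≗ , Δc' , Ψ' =
    D ∨ E , (λ y → cong₂ _++_ (D≗ y) (E≗ y)) , cong₂ _++_ Δc Δc' , ⇒e* ps js Φ' st Ψ'
  unshiftNT c (mu k) (#e {Δ = Δ} {U = U} Φ st) with unshiftNC (suc c) k Φ
  ... | D , D≗ , Δc , Φ' =
    D ∘ suc , (λ y → trans (D≗ (suc y)) (cong Δ (sh-suc c y))) , Δc ,
    #e Φ' (subst (λ V → StarU V U) (sym (D≗ 0)) st)

  unshiftNC : ∀ c k {Γ Δ} → Γ ⊢c shiftNC c k ∶#∣ Δ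
    → Σ[ D ∈ NameCtx ] (D ≗ Δ ∘ sh c × Δ c ≡ [] × Γ ⊢c k ∶#∣ D)
  unshiftNC c (named β t) (#i {U = U} _ Φ) with unshiftNT c t Φ
  ... | D , D≗ , Δc , Φ' =
    D ∨ singleN β U , (λ y → cong₂ _++_ (D≗ y) (sym (singleN-sh c β U y))) ,
    cong₂ _++_ Δc (singleN-off U (sh-avoids c β)) , #i β Φ'

  unshiftNI : ∀ c u {Γ I Δ} → Γ ⊩ shiftNT c u ∶ I ∣ Δ
    → Σ[ D ∈ NameCtx ] (D ≗ Δ ∘ sh c × Δ c ≡ [] × Γ ⊩ u ∶ I ∣ D)
  unshiftNI c u ∧-nil = emptyN , (λ _ → refl) , refl , ∧-nil
  unshiftNI c u (∧-cons Φ Ψ) with unshiftNT c u Φ | unshiftNI c u Ψ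
  ... | D , D≗ , Δc , Φ' | E , E≗ , Δc' , Ψ' =
    D ∨ E , (λ y → cong₂ _++_ (D≗ y) (E≗ y)) , cong₂ _++_ Δc Δc' , ∧-cons Φ' Ψ'

record Split (α : ℕ) (u : Term) (P : VarCtx → NameCtx → Set)
             (Γ₁ : VarCtx) (Δ₁ : NameCtx) : Set where
  constructor split
  field
    {Γo} : VarCtx
    {Δo} : NameCtx
    {Γu} : VarCtx
    {Δu} : NameCtx
    ks : List (Inter × Uni)
    js : List Inter
    objectD : P Γo Δo
    argumentD : Γu ⊩ u ∶ concat js ∣ Δu
    stars : Pointwise StarI (map proj₁ ks) js
    Γ-split : ∀ x → Interleaving (Γo x) (Γu x) (Γ₁ x)
    Δ-split : ∀ β → β ≢ α → Interleaving (Δo β) (Δu β) (Δ₁ β)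
    Δ₁-at-α : Δ₁ α ≡ concatMap proj₂ ks
    Δo-at-α : Δo α ≡ arrows ks

trivialSplit : ∀ {α u P Γ Δ} → P Γ Δ → Δ α ≡ [] → Split α u P Γ Δ
trivialSplit {Γ = Γ} {Δ} Φ Δα =
  split [] [] Φ ∧-nil [] (interleaveˡ ∘ Γ) (λ β _ → interleaveˡ (Δ β)) Δα Δα

mapSplit : ∀ {α u P Q Γ Δ} → (∀ {Γ Δ} → P Γ Δ → Q Γ Δ) → Split α u P Γ Δ → Split α u Q Γ Δ
mapSplit f (split ks js Φ Ψ st Γs Δs Δ₁α Δoα) = split ks js (f Φ) Ψ st Γs Δs Δ₁α Δoα

respSplit : ∀ {α u P Γ Δ Γ' Δ'} → Γ ≗ Γ' → Δ ≗ Δ' → Split α u P Γ Δ → Split α u P Γ' Δ'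
respSplit {α} Γ≗ Δ≗ (split ks js Φ Ψ st Γs Δs Δ₁α Δoα) =
  split ks js Φ Ψ st
    (λ x → subst (Interleaving _ _) (Γ≗ x) (Γs x))
    (λ β ne → subst (Interleaving _ _) (Δ≗ β) (Δs β ne))
    (trans (sym (Δ≗ α)) Δ₁α) Δoα

combine : ∀ {α u P Q R Γ₁ Δ₁ Γ₂ Δ₂} → Split α u P Γ₁ Δ₁ → Split α u Q Γ₂ Δ₂
  → (∀ {Γa Δa Γb Δb} → P Γa Δa → Q Γb Δb → Joint R Γa Γb Δa Δb)
  → Split α u R (Γ₁ ∧ Γ₂) (Δ₁ ∨ Δ₂)
combine {α} {u} (split ksa jsa Φa Ψa sta Γsa Δsa Δ₁αa Δoαa)
                (split ksb jsb Φb Ψb stb Γsb Δsb Δ₁αb Δoαb) join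
  with join Φa Φb | ⊩-++ Ψa Ψb
... | joint Γ≗ Δ≗ Φ | joint {Γu} {Δu} Γu≗ Δu≗ Ψ =
  split (ksa ++ ksb) (jsa ++ jsb) Φ
    (subst (λ I → Γu ⊩ u ∶ I ∣ Δu) (concat-++ jsa jsb) Ψ)
    (subst (λ ds → Pointwise StarI ds (jsa ++ jsb)) (sym (map-++ proj₁ ksa ksb))
           (Pointwise.++⁺ sta stb))
    (λ x → subst₂ (λ l r → Interleaving l r _) (sym (Γ≗ x)) (sym (Γu≗ x))
                  (Interleaving.++⁺ (Γsa x) (Γsb x)))
    (λ β ne → subst₂ (λ l r → Interleaving l r _) (sym (Δ≗ β)) (sym (Δu≗ β))
                     (Interleaving.++⁺ (Δsa β ne) (Δsb β ne)))
    (trans (cong₂ _++_ Δ₁αa Δ₁αb) (sym (concatMap-++ proj₂ ksa ksb)))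
    (trans (Δ≗ α) (trans (cong₂ _++_ Δoαa Δoαb) (sym (map-++ _ ksa ksb))))

argumentSplit : ∀ {α u Γ Δ ks js} → ¬ α ∈fnT u
  → Γ ⊩ u ∶ concat js ∣ Δ → Pointwise StarI (map proj₁ ks) js
  → Split α u (λ Γo Δo → Γo ≗ emptyV × Δo ≗ singleN α (arrows ks))
          Γ (Δ ∨ singleN α (concatMap proj₂ ks))
argumentSplit {α} {Γ = Γ} {Δ} {ks} α∉u Ψ st =
  split ks _ ((λ _ → refl) , (λ _ → refl)) Ψ st (interleaveʳ ∘ Γ) Δ-split
    (cong₂ _++_ (unassignedI α∉u Ψ) (singleN-at α _)) (singleN-at α _)
  where
  Δ-split : ∀ β → β ≢ α
    → Interleaving (singleN α (arrows ks) β) (Δ β) (Δ β ++ singleN α (concatMap proj₂ ks) β)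
  Δ-split β ne rewrite singleN-off (arrows ks) ne | singleN-off (concatMap proj₂ ks) ne
                     | ++-identityʳ (Δ β) = interleaveʳ (Δ β)

namedJoint : ∀ {t} γ {V Γa Δa Γb Δb} → Γa ⊢t t ∶ V ∣ Δa
  → Γb ≗ emptyV × Δb ≗ singleN γ V
  → Joint (λ Γ Δ → Γ ⊢c named γ t ∶#∣ Δ) Γa Γb Δa Δb
namedJoint γ {Γa = Γa} {Δa} Φ (Γb≗ , Δb≗) =
  joint (λ x → trans (sym (++-identityʳ (Γa x))) (cong (Γa x ++_) (sym (Γb≗ x))))
        (λ β → cong (Δa β ++_) (sym (Δb≗ β)))
        (#i γ Φ)

mutual
  splitT : ∀ t α u → ¬ α ∈fnT u → ∀ {Γ₁ U Δ₁} → Γ₁ ⊢t replT t α u ∶ U ∣ Δ₁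
    → Split α u (λ Γ Δ → Γ ⊢t t ∶ U ∣ Δ) Γ₁ Δ₁
  splitT (var x) α u α∉u Φ@(ax _ _ _) = trivialSplit Φ refl
  splitT (lam t) α u α∉u (⇒i {Γ = Γ₁} {U = U} Φ)
    with splitT t α (shiftVT 0 u) (α∉u ∘ fn-shiftVT 0 u) Φ
  ... | split {Γo} {Δo} ks js Φ' Ψ st Γs Δs Δ₁α Δoα with unshiftVI 0 u Ψ
  ... | G , G≗ , Γu0 , Ψ' =
    split ks js
      (subst (λ I → (Γo ∘ suc) ⊢t lam t ∶ ((I ⇒ U) ∷ []) ∣ Δo)
             (interleave-[]ʳ (Γs 0) Γu0) (⇒i Φ'))
      Ψ' st
      (λ x → subst (λ r → Interleaving _ r (Γ₁ (suc x))) (sym (G≗ x)) (Γs (suc x)))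
      Δs Δ₁α Δoα
  splitT (app t s) α u α∉u (⇒e* ps js Φ st Ψ) =
    combine (splitT t α u α∉u Φ) (splitI s α u α∉u Ψ) (λ Φt Φs → exactJoint (⇒e* ps js Φt st Φs))
  splitT (mu c) α u α∉u (#e {Δ = Δ₁} {U = U} Φ st)
    with splitC c (suc α) (shiftNT 0 u) (α∉u ∘ fn-shiftNT 0 u z≤n) Φ
  ... | split ks js Φ' Ψ st' Γs Δs Δ₁α Δoα with unshiftNI 0 u Ψ
  ... | D , D≗ , Δu0 , Ψ' =
    split ks js
      (#e Φ' (subst (λ V → StarU V U) (sym (interleave-[]ʳ (Δs 0 λ ()) Δu0)) st))
      Ψ' st' Γs
      (λ β ne → subst (λ r → Interleaving _ r (Δ₁ (suc β))) (sym (D≗ β))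
                      (Δs (suc β) (ne ∘ suc-injective)))
      Δ₁α Δoα

  splitC : ∀ c α u → ¬ α ∈fnT u → ∀ {Γ₁ Δ₁} → Γ₁ ⊢c replC c α u ∶#∣ Δ₁
    → Split α u (λ Γ Δ → Γ ⊢c c ∶#∣ Δ) Γ₁ Δ₁
  splitC (named γ t) α u α∉u Φ with γ ≡ᵇ α in eq
  ... | true with ≡ᵇ⇒≡ γ α (subst T (sym eq) tt)
  ...   | refl = splitReplaced t α u α∉u Φ
  splitC (named γ t) α u α∉u Φ | false = splitUnreplaced t γ α u α∉u (≡ᵇ-false⇒≢ eq) Φ

  splitReplaced : ∀ t α u → ¬ α ∈fnT u → ∀ {Γ₁ Δ₁}
    → Γ₁ ⊢c named α (app (replT t α u) u) ∶#∣ Δ₁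
    → Split α u (λ Γ Δ → Γ ⊢c named α t ∶#∣ Δ) Γ₁ Δ₁
  splitReplaced t α u α∉u (#i _ (⇒e* {Δt = Δt} {Δu = Δu} ps js Φ st Ψ)) =
    respSplit (λ _ → refl) (λ β → sym (++-assoc (Δt β) (Δu β) _))
      (combine (splitT t α u α∉u Φ) (argumentSplit α∉u Ψ st) (namedJoint α))

  splitUnreplaced : ∀ t γ α u → ¬ α ∈fnT u → α ≢ γ → ∀ {Γ₁ Δ₁}
    → Γ₁ ⊢c named γ (replT t α u) ∶#∣ Δ₁
    → Split α u (λ Γ Δ → Γ ⊢c named γ t ∶#∣ Δ) Γ₁ Δ₁
  splitUnreplaced t γ α u α∉u α≢γ (#i {Γ = Γt} {U = U} _ Φ) =
    respSplit (++-identityʳ ∘ Γt) (λ _ → refl)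
      (combine (splitT t α u α∉u Φ)
               (trivialSplit ((λ _ → refl) , (λ _ → refl)) (singleN-off U α≢γ))
               (namedJoint γ))

  splitI : ∀ t α u → ¬ α ∈fnT u → ∀ {Γ₁ I Δ₁} → Γ₁ ⊩ replT t α u ∶ I ∣ Δ₁
    → Split α u (λ Γ Δ → Γ ⊩ t ∶ I ∣ Δ) Γ₁ Δ₁
  splitI t α u α∉u ∧-nil = trivialSplit ∧-nil refl
  splitI t α u α∉u (∧-cons Φ Ψ) =
    combine (splitT t α u α∉u Φ) (splitI t α u α∉u Ψ) (λ Φ₁ Φ₂ → exactJoint (∧-cons Φ₁ Φ₂))

splitO : ∀ o α u → ¬ α ∈fnT u → ∀ {Γ₁ A Δ₁} → Γ₁ ⊢o repl o α u ∶ A ∣ Δ₁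
  → Split α u (λ Γ Δ → Γ ⊢o o ∶ A ∣ Δ) Γ₁ Δ₁
splitO (term t) α u α∉u (o-term Φ) = mapSplit o-term (splitT t α u α∉u Φ)
splitO (cmd c) α u α∉u (o-cmd Φ) = mapSplit o-cmd (splitC c α u α∉u Φ)

eraseN : ℕ → NameCtx → NameCtx
eraseN α Δ β = if β ≡ᵇ α then [] else Δ β

eraseN-at : ∀ α Δ → eraseN α Δ α ≡ []
eraseN-at α Δ rewrite ≡ᵇ-refl α = refl

eraseN-off : ∀ {α β} Δ → β ≢ α → eraseN α Δ β ≡ Δ β
eraseN-off Δ ne rewrite ≡ᵇ-false ne = refl

eraseN-split : ∀ α (Δ : NameCtx) → Δ ≈Δ (singleN α (Δ α) ∨ eraseN α Δ)
eraseN-split α Δ β with β ≟ α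
... | yes refl rewrite singleN-at α (Δ α) | eraseN-at α Δ = U.↭-sym (U.↭-reflexive (++-identityʳ (Δ α)))
... | no ne rewrite singleN-off (Δ α) ne | eraseN-off Δ ne = reflU (Δ β)

nameSplit : ∀ {α V Δ' Δ₁ Δo Δu} → Δ' α ≡ [] → Δu α ≡ []
  → Δ₁ ≈Δ (singleN α V ∨ Δ') → (∀ β → β ≢ α → Interleaving (Δo β) (Δu β) (Δ₁ β))
  → Δ' ≈Δ (eraseN α Δo ∨ Δu)
nameSplit {α} {V} {Δ'} {Δo = Δo} Δ'α Δuα Δ₁≈ Δs β with β ≟ α
... | yes refl rewrite Δ'α | eraseN-at α Δo | Δuα = reflU []
... | no ne rewrite eraseN-off Δo ne = begin
  Δ' β                    ≡⟨ cong (_++ Δ' β) (singleN-off V ne) ⟨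
  singleN α V β ++ Δ' β   ↭⟨ Δ₁≈ β ⟨
  _                       ↭⟨ U.interleaving⇒↭ (Δs β ne) ⟩
  Δo β ++ _               ∎
  where open U.PermutationReasoning

typeOfα : ∀ {α V Δ' Δ₁ W} → Δ' α ≡ [] → Δ₁ ≈Δ (singleN α V ∨ Δ') → Δ₁ α ≡ W → V ≈U W
typeOfα {α} {V} {Δ'} Δ'α Δ₁≈ Δ₁α = begin
  V                       ≡⟨ ++-identityʳ V ⟨
  V ++ []                 ≡⟨ cong₂ _++_ (singleN-at α V) Δ'α ⟨
  singleN α V α ++ Δ' α   ↭⟨ Δ₁≈ α ⟨
  _                       ≡⟨ Δ₁α ⟩
  _                       ∎
  where open U.PermutationReasoning

lemma5p3 : (o : Obj) (α : ℕ) (u : Term) → ¬ (α ∈fnT u)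
    → (Γ' : VarCtx) (A : ObjTy) (V : Uni) (Δ' : NameCtx) → Δ' α ≡ []
    → DerivableO Γ' (repl o α u) A (singleN α V ∨ Δ')
    → Σ[ Γ ∈ VarCtx ] Σ[ Δ ∈ NameCtx ] Σ[ Γu ∈ VarCtx ] Σ[ Δu ∈ NameCtx ]
      Σ[ ks ∈ List (Inter × Uni) ]
        (Γ' ≈Γ (Γ ∧ Γu)) × (Δ' ≈Δ (Δ ∨ Δu)) × (V ≈U concatMap proj₂ ks)
        × Δ α ≡ []
        × DerivableO Γ o A (singleN α (arrows ks) ∨ Δ)
        × (Σ[ js ∈ List Inter ] (Pointwise StarI (map proj₁ ks) js
             × DerivableI Γu u (concat js) Δu))
lemma5p3 o α u α∉u Γ' A V Δ' Δ'α (Γ₁ , A₁ , Δ₁ , Γ₁≈ , A₁≈ , Δ₁≈ , Φ)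
  with splitO o α u α∉u Φ
... | split {Γo} {Δo} {Γu} {Δu} ks js Φo Ψ st Γs Δs Δ₁α Δoα =
  Γo , eraseN α Δo , Γu , Δu , ks ,
  (λ x → Perm.trans (symI (Γ₁≈ x)) (I.interleaving⇒↭ (Γs x))) ,
  nameSplit Δ'α (unassignedI α∉u Ψ) Δ₁≈ Δs ,
  typeOfα Δ'α Δ₁≈ Δ₁α ,
  eraseN-at α Δo ,
  (Γo , A₁ , Δo , reflI ∘ Γo , A₁≈ ,
   subst (λ W → Δo ≈Δ (singleN α W ∨ eraseN α Δo)) Δoα (eraseN-split α Δo) , Φo) ,
  js , st , (Γu , concat js , Δu , reflI ∘ Γu , reflI (concat js) , reflU ∘ Δu , Ψ)
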